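{- In a pre-Hilbert category, $\dagger$-subobjects are stable under pullback: if $n:N\to Y$ is a $\dagger$-mono and $f:X\to Y$ is any morphism, then the pullback of $n$ along $f$, as a subobject of $X$, is represented by a $\dagger$-mono.
   Context: A $\dagger$-category is a category $\mathcal{H}$ with a functor $\dagger:\mathcal{H}^{\mathrm{op}}\to\mathcal{H}$ that is the identity on objects with $f^{\dagger\dagger}=f$. A morphism $m$ is a $\dagger$-mono if $m^\dagger m=\mathrm{id}$, a $\dagger$-epi if $mm^\dagger=\mathrm{id}$. A pre-Hilbert category is a $\dagger$-category such that: it has finite $\dagger$-biproducts (finite biproducts, including a zero object, with $\pi^\dagger=\kappa$); it has finite $\dagger$-equalisers (equalisers that are $\dagger$-monos); every $\dagger$-mono is a kernel of some morphism; and it is symmetric $\dagger$-monoidal ($(f\otimes g)^\dagger=f^\dagger\otimes g^\dagger$, coherence isomorphisms $\dagger$-isos). A subobject of $X$ is an equivalence class of monos into $X$ ($m$ and $n$ equivalent if $nf=m$ for an isomorphism $f$); a $\dagger$-subobject is one representable by a $\dagger$-mono. -}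

module Defs where

open import Level using (Level; _⊔_) renaming (suc to lsuc)
open import Relation.Binary.PropositionalEquality using (_≡_)
open import Data.Product using (Σ; _×_; _,_; proj₁; proj₂)

∃!⟨_⟩ : ∀ {a p} {A : Set a} → (A → Set p) → Set (a ⊔ p)
∃!⟨_⟩ {A = A} P = Σ A λ x → P x × (∀ y → P y → y ≡ x)

record DaggerCategory (o ℓ : Level) : Set (lsuc (o ⊔ ℓ)) where
  infixr 9 _∘_
  infix 10 _†
  field
    Obj : Set o
    Hom : Obj → Obj → Set ℓ
    id  : ∀ {A} → Hom A A
    _∘_ : ∀ {A B C} → Hom B C → Hom A B → Hom A C
    assoc     : ∀ {A B C D} (f : Hom A B) (g : Hom B C) (h : Hom C D) →
                (h ∘ g) ∘ f ≡ h ∘ (g ∘ f)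
    identityˡ : ∀ {A B} (f : Hom A B) → id ∘ f ≡ f
    identityʳ : ∀ {A B} (f : Hom A B) → f ∘ id ≡ f
    _†        : ∀ {A B} → Hom A B → Hom B A
    †-id      : ∀ {A} → id {A} † ≡ id
    †-∘       : ∀ {A B C} (f : Hom A B) (g : Hom B C) → (g ∘ f) † ≡ f † ∘ g †
    †-invol   : ∀ {A B} (f : Hom A B) → f † † ≡ f

  Mono : ∀ {A B} → Hom A B → Set (o ⊔ ℓ)
  Mono {A} f = ∀ {C} (g h : Hom C A) → f ∘ g ≡ f ∘ h → g ≡ h

  IsIso : ∀ {A B} → Hom A B → Set ℓ
  IsIso {A} {B} f = Σ (Hom B A) λ g → (g ∘ f ≡ id) × (f ∘ g ≡ id)

  DaggerMono : ∀ {A B} → Hom A B → Set ℓ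
  DaggerMono m = m † ∘ m ≡ id

  DaggerEpi : ∀ {A B} → Hom A B → Set ℓ
  DaggerEpi m = m ∘ m † ≡ id

  DaggerIso : ∀ {A B} → Hom A B → Set ℓ
  DaggerIso m = DaggerMono m × DaggerEpi m

  IsInitial : Obj → Set (o ⊔ ℓ)
  IsInitial I = ∀ A → ∃!⟨ (λ (f : Hom I A) → f ≡ f) ⟩

  IsTerminal : Obj → Set (o ⊔ ℓ)
  IsTerminal T = ∀ A → ∃!⟨ (λ (f : Hom A T) → f ≡ f) ⟩

  IsZeroObject : Obj → Set (o ⊔ ℓ)
  IsZeroObject Z = IsInitial Z × IsTerminal Z

  IsEqualiser : ∀ {A B E} → Hom A B → Hom A B → Hom E A → Set (o ⊔ ℓ)
  IsEqualiser {A} f g e =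
    (f ∘ e ≡ g ∘ e) ×
    (∀ {C} (h : Hom C A) → f ∘ h ≡ g ∘ h → ∃!⟨ (λ (k : Hom C _) → e ∘ k ≡ h) ⟩)

  IsProduct : ∀ {A B P} → Hom P A → Hom P B → Set (o ⊔ ℓ)
  IsProduct {A} {B} {P} π₁ π₂ =
    ∀ {C} (f : Hom C A) (g : Hom C B) →
      ∃!⟨ (λ (h : Hom C P) → (π₁ ∘ h ≡ f) × (π₂ ∘ h ≡ g)) ⟩

  IsCoproduct : ∀ {A B P} → Hom A P → Hom B P → Set (o ⊔ ℓ)
  IsCoproduct {A} {B} {P} κ₁ κ₂ =
    ∀ {C} (f : Hom A C) (g : Hom B C) →
      ∃!⟨ (λ (h : Hom P C) → (h ∘ κ₁ ≡ f) × (h ∘ κ₂ ≡ g)) ⟩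

  IsPullback : ∀ {X Y N P} → Hom N Y → Hom X Y → Hom P X → Hom P N → Set (o ⊔ ℓ)
  IsPullback {X} {Y} {N} {P} n f p₁ p₂ =
    (f ∘ p₁ ≡ n ∘ p₂) ×
    (∀ {Q} (q₁ : Hom Q X) (q₂ : Hom Q N) → f ∘ q₁ ≡ n ∘ q₂ →
      ∃!⟨ (λ (u : Hom Q P) → (p₁ ∘ u ≡ q₁) × (p₂ ∘ u ≡ q₂)) ⟩)

record PreHilbertCategory (o ℓ : Level) : Set (lsuc (o ⊔ ℓ)) where
  field
    daggerCategory : DaggerCategory o ℓ
  open DaggerCategory daggerCategory public

  -- finite †-biproducts: a zero object and binary †-biproducts
  field
    𝟘        : Obj
    𝟘-isZero : IsZeroObject 𝟘

  zeroHom : ∀ {A B} → Hom A B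
  zeroHom {A} {B} = proj₁ (proj₁ 𝟘-isZero B) ∘ proj₁ (proj₂ 𝟘-isZero A)

  IsKernel : ∀ {A B K} → Hom A B → Hom K A → Set (o ⊔ ℓ)
  IsKernel f k = IsEqualiser f zeroHom k

  field
    _⊕_ : Obj → Obj → Obj
    π₁  : ∀ {A B} → Hom (A ⊕ B) A
    π₂  : ∀ {A B} → Hom (A ⊕ B) B
    κ₁  : ∀ {A B} → Hom A (A ⊕ B)
    κ₂  : ∀ {A B} → Hom B (A ⊕ B)
    ⊕-product   : ∀ {A B} → IsProduct (π₁ {A} {B}) π₂
    ⊕-coproduct : ∀ {A B} → IsCoproduct (κ₁ {A} {B}) κ₂
    π₁κ₁ : ∀ {A B} → π₁ {A} {B} ∘ κ₁ ≡ id
    π₂κ₂ : ∀ {A B} → π₂ {A} {B} ∘ κ₂ ≡ id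
    π₁κ₂ : ∀ {A B} → π₁ {A} {B} ∘ κ₂ ≡ zeroHom
    π₂κ₁ : ∀ {A B} → π₂ {A} {B} ∘ κ₁ ≡ zeroHom
    π₁-† : ∀ {A B} → π₁ {A} {B} † ≡ κ₁
    π₂-† : ∀ {A B} → π₂ {A} {B} † ≡ κ₂

    equaliser : ∀ {A B} (f g : Hom A B) →
      Σ Obj λ E → Σ (Hom E A) λ e → IsEqualiser f g e × DaggerMono e

    †mono-kernel : ∀ {M X} (m : Hom M X) → DaggerMono m →
      Σ Obj λ Z → Σ (Hom X Z) λ f → IsKernel f m

  infixr 10 _⊗₀_ _⊗₁_
  field
    _⊗₀_ : Obj → Obj → Obj
    _⊗₁_ : ∀ {A B C D} → Hom A B → Hom C D → Hom (A ⊗₀ C) (B ⊗₀ D)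
    ⊗-id : ∀ {A C} → id {A} ⊗₁ id {C} ≡ id
    ⊗-∘  : ∀ {A B C D E F} (f : Hom A B) (g : Hom B C) (h : Hom D E) (k : Hom E F) →
           (g ∘ f) ⊗₁ (k ∘ h) ≡ (g ⊗₁ k) ∘ (f ⊗₁ h)
    𝟙 : Obj
    α : ∀ {A B C} → Hom ((A ⊗₀ B) ⊗₀ C) (A ⊗₀ (B ⊗₀ C))
    λ′ : ∀ {A} → Hom (𝟙 ⊗₀ A) A
    ρ : ∀ {A} → Hom (A ⊗₀ 𝟙) A
    σ : ∀ {A B} → Hom (A ⊗₀ B) (B ⊗₀ A)
    α-natural : ∀ {A A′ B B′ C C′} (f : Hom A A′) (g : Hom B B′) (h : Hom C C′) →
      α ∘ ((f ⊗₁ g) ⊗₁ h) ≡ (f ⊗₁ (g ⊗₁ h)) ∘ α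
    λ-natural : ∀ {A A′} (f : Hom A A′) → λ′ ∘ (id ⊗₁ f) ≡ f ∘ λ′
    ρ-natural : ∀ {A A′} (f : Hom A A′) → ρ ∘ (f ⊗₁ id) ≡ f ∘ ρ
    σ-natural : ∀ {A A′ B B′} (f : Hom A A′) (g : Hom B B′) →
      σ ∘ (f ⊗₁ g) ≡ (g ⊗₁ f) ∘ σ
    pentagon : ∀ {A B C D} →
      α {A} {B} {C ⊗₀ D} ∘ α {A ⊗₀ B} {C} {D}
        ≡ (id ⊗₁ α) ∘ (α {A} {B ⊗₀ C} {D} ∘ (α ⊗₁ id))
    triangle : ∀ {A B} → (id {A} ⊗₁ λ′ {B}) ∘ α ≡ ρ ⊗₁ id
    hexagon : ∀ {A B C} →
      α {B} {C} {A} ∘ (σ {A} {B ⊗₀ C} ∘ α)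
        ≡ (id ⊗₁ σ) ∘ (α {B} {A} {C} ∘ (σ ⊗₁ id))
    symmetry : ∀ {A B} → σ {B} {A} ∘ σ {A} {B} ≡ id
    ⊗-† : ∀ {A B C D} (f : Hom A B) (g : Hom C D) → (f ⊗₁ g) † ≡ (f †) ⊗₁ (g †)
    α-†iso : ∀ {A B C} → DaggerIso (α {A} {B} {C})
    λ-†iso : ∀ {A} → DaggerIso (λ′ {A})
    ρ-†iso : ∀ {A} → DaggerIso (ρ {A})
    σ-†iso : ∀ {A B} → DaggerIso (σ {A} {B})

-- Write the †-mono n as a kernel of some g.  A kernel of g ∘ f is then a
-- pullback of n along f, and the chosen †-equaliser of g ∘ f and 0 is such a
-- kernel that is moreover a †-mono.  Pullbacks of the same cospan agree up to
-- isomorphism, so the given pullback is represented by it.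
module Submission where

open import Defs
open import Level using (Level)
open import Relation.Binary.PropositionalEquality
  using (_≡_; refl; sym; trans; cong; module ≡-Reasoning)
open import Data.Product using (Σ; _×_; _,_; proj₁; proj₂)

module Category {o ℓ : Level} (𝒞 : DaggerCategory o ℓ) where
  open DaggerCategory 𝒞

  ∘-pullʳ : ∀ {A B C D} {a : Hom C D} {b : Hom B C} {c : Hom B D}
              {d : Hom A B} {e : Hom A D} →
            a ∘ b ≡ c → c ∘ d ≡ e → a ∘ (b ∘ d) ≡ e
  ∘-pullʳ {a = a} {b} {d = d} ab≡c cd≡e =
    trans (sym (assoc d b a)) (trans (cong (_∘ d) ab≡c) cd≡e)

  equaliser⇒mono : ∀ {A B E} {f g : Hom A B} {e : Hom E A} →
                   IsEqualiser f g e → Mono e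
  equaliser⇒mono {f = f} {g} {e} (fe≡ge , universal) a b ea≡eb =
    let (_ , _ , unique) = universal (e ∘ a) (∘-pullʳ fe≡ge (assoc a e g))
    in trans (unique a refl) (sym (unique b (sym ea≡eb)))

  pullback-endo≡id : ∀ {X Y N P} {n : Hom N Y} {f : Hom X Y}
                       {p₁ : Hom P X} {p₂ : Hom P N} {h : Hom P P} →
                     IsPullback n f p₁ p₂ → p₁ ∘ h ≡ p₁ → p₂ ∘ h ≡ p₂ → h ≡ id
  pullback-endo≡id {p₁ = p₁} {p₂} {h} (commutes , universal) p₁h≡p₁ p₂h≡p₂ =
    let (_ , _ , unique) = universal p₁ p₂ commutes
    in trans (unique h (p₁h≡p₁ , p₂h≡p₂))
             (sym (unique id (identityʳ p₁ , identityʳ p₂)))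

  pullback-unique : ∀ {X Y N P Q} {n : Hom N Y} {f : Hom X Y}
                      {p₁ : Hom P X} {p₂ : Hom P N} {q₁ : Hom Q X} {q₂ : Hom Q N} →
                    IsPullback n f p₁ p₂ → IsPullback n f q₁ q₂ →
                    Σ (Hom Q P) λ i → IsIso i × (p₁ ∘ i ≡ q₁)
  pullback-unique p@(p-commutes , p-universal) q@(q-commutes , q-universal) =
    let (i , (p₁i≡q₁ , p₂i≡q₂) , _) = p-universal _ _ q-commutes
        (j , (q₁j≡p₁ , q₂j≡p₂) , _) = q-universal _ _ p-commutes
    in i
     , ( j
       , pullback-endo≡id q (∘-pullʳ q₁j≡p₁ p₁i≡q₁) (∘-pullʳ q₂j≡p₂ p₂i≡q₂)
       , pullback-endo≡id p (∘-pullʳ p₁i≡q₁ q₁j≡p₁) (∘-pullʳ p₂i≡q₂ q₂j≡p₂) )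
     , p₁i≡q₁

module PreHilbert {o ℓ : Level} (H : PreHilbertCategory o ℓ) where
  open PreHilbertCategory H
  open Category daggerCategory
  open ≡-Reasoning

  zeroHom-absorbʳ : ∀ {A B C} (h : Hom A B) → zeroHom {B} {C} ∘ h ≡ zeroHom
  zeroHom-absorbʳ {A} h = trans (assoc h _ _) (cong (_ ∘_) (into𝟘-unique _ _))
    where
    into𝟘-unique : (a b : Hom A 𝟘) → a ≡ b
    into𝟘-unique a b = let (_ , _ , unique) = proj₂ 𝟘-isZero A
                       in trans (unique a refl) (sym (unique b refl))

  kernel-kills : ∀ {A B K} {g : Hom A B} {k : Hom K A} → IsKernel g k → g ∘ k ≡ zeroHom
  kernel-kills {k = k} (gk≡0k , _) = trans gk≡0k (zeroHom-absorbʳ k)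

  kernel-factor : ∀ {A B K C} {g : Hom A B} {k : Hom K A} → IsKernel g k →
                  (h : Hom C A) → g ∘ h ≡ zeroHom → ∃!⟨ (λ (v : Hom C K) → k ∘ v ≡ h) ⟩
  kernel-factor (_ , universal) h gh≡0 =
    universal h (trans gh≡0 (sym (zeroHom-absorbʳ h)))

  kernel-pullback : ∀ {X Y Z N E} {g : Hom Y Z} {n : Hom N Y} {f : Hom X Y}
                      {e : Hom E X} →
                    IsKernel g n → IsKernel (g ∘ f) e →
                    Σ (Hom E N) λ u → IsPullback n f e u
  kernel-pullback {X} {N = N} {E = E} {g} {n} {f} {e} n-kernel e-kernel =
    u , sym nu≡fe , universal
    where
    fe-through-n : ∃!⟨ (λ (v : Hom E N) → n ∘ v ≡ f ∘ e) ⟩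
    fe-through-n = kernel-factor n-kernel (f ∘ e)
      (trans (sym (assoc e f g)) (kernel-kills e-kernel))

    u : Hom E N
    u = proj₁ fe-through-n

    nu≡fe : n ∘ u ≡ f ∘ e
    nu≡fe = proj₁ (proj₂ fe-through-n)

    universal : ∀ {Q} (q₁ : Hom Q X) (q₂ : Hom Q N) → f ∘ q₁ ≡ n ∘ q₂ →
                ∃!⟨ (λ (v : Hom Q E) → (e ∘ v ≡ q₁) × (u ∘ v ≡ q₂)) ⟩
    universal q₁ q₂ fq₁≡nq₂ =
      let (v , ev≡q₁ , unique) = kernel-factor e-kernel q₁ gfq₁≡0
      in v , (ev≡q₁ , u-factor v ev≡q₁) , λ w (ew≡q₁ , _) → unique w ew≡q₁
      where
      gfq₁≡0 : (g ∘ f) ∘ q₁ ≡ zeroHom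
      gfq₁≡0 = begin
        (g ∘ f) ∘ q₁    ≡⟨ assoc q₁ f g ⟩
        g ∘ (f ∘ q₁)    ≡⟨ cong (g ∘_) fq₁≡nq₂ ⟩
        g ∘ (n ∘ q₂)    ≡⟨ ∘-pullʳ (kernel-kills n-kernel) (zeroHom-absorbʳ q₂) ⟩
        zeroHom         ∎

      u-factor : (v : Hom _ E) → e ∘ v ≡ q₁ → u ∘ v ≡ q₂
      u-factor v ev≡q₁ = equaliser⇒mono n-kernel (u ∘ v) q₂ (begin
        n ∘ (u ∘ v)     ≡⟨ ∘-pullʳ nu≡fe refl ⟩
        (f ∘ e) ∘ v     ≡⟨ assoc v e f ⟩
        f ∘ (e ∘ v)     ≡⟨ cong (f ∘_) ev≡q₁ ⟩
        f ∘ q₁          ≡⟨ fq₁≡nq₂ ⟩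
        n ∘ q₂          ∎)

open PreHilbert

lemma4 : ∀ {o ℓ : Level} (H : PreHilbertCategory o ℓ) →
    let open PreHilbertCategory H in
    ∀ {X Y N P} (n : Hom N Y) (f : Hom X Y) (p₁ : Hom P X) (p₂ : Hom P N) →
    DaggerMono n → IsPullback n f p₁ p₂ →
    Σ Obj λ M → Σ (Hom M X) λ m → DaggerMono m ×
    (Σ (Hom M P) λ i → IsIso i × (p₁ ∘ i ≡ m))
lemma4 H n f p₁ p₂ n-†mono pullback =
  let open PreHilbertCategory H
      (_ , g , n-kernel) = †mono-kernel n n-†mono
      (E , e , e-kernel , e-†mono) = equaliser (g ∘ f) zeroHom
      (_ , e-pullback) = kernel-pullback H n-kernel e-kernel
  in E , e , e-†mono , Category.pullback-unique daggerCategory pullback e-pullback
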